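{- Let $S$ be a numerical semigroup and $\theta$ an $\mathrm{i}$-pertinent map. Define $S_0=S$ and, for $n\in\mathbb{N}$, $S_{n+1}=S_n\cup\theta(S_n)$ if $S_n\neq\mathbb{N}$ and $S_{n+1}=\mathbb{N}$ otherwise. Then there exists $\mu(\theta,S)\in\mathbb{N}$ such that $S=S_0\subsetneq S_1\subsetneq\dots\subsetneq S_{\mu(\theta,S)}=\mathbb{N}$. Moreover, this chain is an $\mathrm{i}$-chain.
   Context: A numerical semigroup is a subset $S\subseteq\mathbb{N}$ containing $0$, closed under addition, with finite complement in $\mathbb{N}$. $\mathcal{L}$ denotes the set of all numerical semigroups. $\mathrm{PF}(S)$ is the set of integers $x\notin S$ with $x+s\in S$ for all $s\in S\setminus\{0\}$. A set $A$ is $\mathrm{i}(S)$-pertinent if $A\subseteq\mathrm{PF}(S)$ and, whenever $\{a,b\}\subseteq A$ and $a+b\in\mathrm{PF}(S)$, then $a+b\in A$. A map $\theta:\mathcal{L}\setminus\{\mathbb{N}\}\to\mathscr{P}(\mathbb{N})$ is $\mathrm{i}$-pertinent if $\theta(S)$ is a nonempty $\mathrm{i}(S)$-pertinent set for every $S\in\mathcal{L}\setminus\{\mathbb{N}\}$. An ideal of a numerical semigroup $\Delta$ is a nonempty $I\subseteq\Delta$ with $I+\Delta\subseteq I$; $\mathcal{J}(\Delta)$ is the set of numerical semigroups $T$ with $T\setminus\{0\}$ an ideal of $\Delta$. An $\mathrm{i}$-chain of length $n$ is a chain of numerical semigroups $S_0\subseteq\dots\subseteq S_n$ with $S_i\in\mathcal{J}(S_{i+1})$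 for all $i\in\{0,\dots,n-1\}$. -}

module Defs where

open import Data.Nat using (ℕ; zero; suc; _+_; _<_; _≡ᵇ_)
open import Data.Bool using (Bool; true; false; _∨_; _∧_; not)
open import Data.Product using (Σ; ∃; _×_; _,_)
open import Relation.Binary.PropositionalEquality using (_≡_)
open import Relation.Nullary using (¬_)

Subset : Set
Subset = ℕ → Bool

infix 4 _∈_ _∉_ _⊆_ _⊊_
_∈_ : ℕ → Subset → Set
x ∈ A = A x ≡ true

_∉_ : ℕ → Subset → Set
x ∉ A = ¬ (x ∈ A)

_⊆_ : Subset → Subset → Set
A ⊆ B = ∀ x → x ∈ A → x ∈ B

_⊊_ : Subset → Subset → Set
A ⊊ B = (A ⊆ B) × (∃ λ x → (x ∈ B) × (x ∉ A))

_∪_ : Subset → Subset → Subset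
(A ∪ B) x = A x ∨ B x

nonzeroPart : Subset → Subset
nonzeroPart A x = A x ∧ not (x ≡ᵇ 0)

Full : Subset → Set
Full A = ∀ x → x ∈ A

Nonempty : Subset → Set
Nonempty A = ∃ λ x → x ∈ A

record NumSg (S : Subset) : Set where
  field
    zero∈  : 0 ∈ S
    closed : ∀ x y → x ∈ S → y ∈ S → (x + y) ∈ S
    cofinite : ∃ λ F → ∀ x → F < x → x ∈ S

-- x ∈ PF(S) (pseudo-Frobenius numbers; for S ≠ ℕ these are all naturals)
PF : Subset → ℕ → Set
PF S x = (x ∉ S) × (∀ s → s ∈ S → ¬ (s ≡ 0) → (x + s) ∈ S)

IPertinentSet : Subset → Subset → Set
IPertinentSet S A =
  (∀ x → x ∈ A → PF S x) ×
  (∀ a b → a ∈ A → b ∈ A → PF S (a + b) → (a + b) ∈ A)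

IPertinentMap : (Subset → Subset) → Set
IPertinentMap θ = ∀ S → NumSg S → ¬ Full S → Nonempty (θ S) × IPertinentSet S (θ S)

IsIdeal : Subset → Subset → Set
IsIdeal I Δ = Nonempty I × (I ⊆ Δ) × (∀ i d → i ∈ I → d ∈ Δ → (i + d) ∈ I)

InJ : Subset → Subset → Set
InJ T Δ = NumSg T × IsIdeal (nonzeroPart T) Δ

{-# OPTIONS --safe #-}
module Submission where

open import Defs
open import Data.Nat using (ℕ; zero; suc; _<_; _≤_; _+_; z≤n; s≤s; _≟_; _≤?_)
open import Data.Nat.Properties
open import Data.Bool using (Bool; true; false; _∨_)
open import Data.Bool.Properties using (∧-zeroʳ; ∧-identityʳ; ¬-not)
import Data.Bool as Bool
open import Data.Product using (∃; _×_; _,_; proj₁; proj₂)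
open import Data.Sum using (_⊎_; inj₁; inj₂; map₂)
open import Function using (_∘_)
open import Relation.Binary.PropositionalEquality using (_≡_; _≢_; refl; sym; trans; subst)
open import Relation.Nullary using (¬_; Dec; yes; no; contradiction)

-- Adjoining to a numerical semigroup T a pertinent set A ⊆ PF(T) gives a
-- numerical semigroup: a pseudo-Frobenius number plus a nonzero element of T
-- lies in T, and a sum of two elements of A is either in T or again
-- pseudo-Frobenius, hence in A by pertinence.  Since T ⊆ T ∪ A ⊆ T ∪ PF(T),
-- the set T ∖ {0} is moreover an ideal of T ∪ A.  Every step adds an element,
-- and every gap of Sₙ is a gap of S, hence at most some fixed F; so the number
-- of gaps below F + 1 strictly decreases until ℕ is reached.

infix 4 _≐_
_≐_ : Subset → Subset → Set
A ≐ B = ∀ x → A x ≡ B x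

≐⇒⊆ : ∀ {A B} → A ≐ B → A ⊆ B
≐⇒⊆ A≐B x x∈A = trans (sym (A≐B x)) x∈A

≐⇒⊇ : ∀ {A B} → A ≐ B → B ⊆ A
≐⇒⊇ A≐B x x∈B = trans (A≐B x) x∈B

infix 4 _∈?_
_∈?_ : ∀ x A → Dec (x ∈ A)
x ∈? A = A x Bool.≟ true

∈-∪⁺ : ∀ {A B x} → x ∈ A ⊎ x ∈ B → x ∈ A ∪ B
∈-∪⁺ {A} {x = x} x∈A⊎B with A x | x∈A⊎B
... | true  | _        = refl
... | false | inj₂ x∈B = x∈B

∈-∪⁻ : ∀ {A B x} → x ∈ A ∪ B → x ∈ A ⊎ x ∈ B
∈-∪⁻ {A} {x = x} x∈A∪B with A x
... | true  = inj₁ refl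
... | false = inj₂ x∈A∪B

∈-nonzeroPart⁺ : ∀ {T x} → x ∈ T → x ≢ 0 → x ∈ nonzeroPart T
∈-nonzeroPart⁺ {T} {zero}  _   x≢0 = contradiction refl x≢0
∈-nonzeroPart⁺ {T} {suc x} x∈T _   = trans (∧-identityʳ (T (suc x))) x∈T

∈-nonzeroPart⁻ : ∀ {T x} → x ∈ nonzeroPart T → x ∈ T × x ≢ 0
∈-nonzeroPart⁻ {T} {zero}  0∈ with () ← trans (sym (∧-zeroʳ (T 0))) 0∈
∈-nonzeroPart⁻ {T} {suc x} x∈ = trans (sym (∧-identityʳ (T (suc x)))) x∈ , λ ()

numSg-≐ : ∀ {A B} → A ≐ B → NumSg B → NumSg A
numSg-≐ A≐B nsB = record
  { zero∈    = ≐⇒⊇ A≐B 0 zero∈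
  ; closed   = λ x y x∈A y∈A →
      ≐⇒⊇ A≐B (x + y) (closed x y (≐⇒⊆ A≐B x x∈A) (≐⇒⊆ A≐B y y∈A))
  ; cofinite = let (F , above) = cofinite in F , λ x F<x → ≐⇒⊇ A≐B x (above x F<x)
  }
  where open NumSg nsB

full⇒numSg : ∀ {A} → Full A → NumSg A
full⇒numSg full = record
  { zero∈ = full 0 ; closed = λ x y _ _ → full (x + y) ; cofinite = 0 , λ x _ → full x }

PF-+ : ∀ {T a b} → PF T a → PF T b → a + b ∉ T → PF T (a + b)
PF-+ {T} {a} {b} (_ , a+T⊆T) (_ , b+T⊆T) a+b∉T = a+b∉T , λ s s∈T s≢0 →
  subst (_∈ T) (sym (+-assoc a b s))
    (a+T⊆T (b + s) (b+T⊆T s s∈T s≢0) (s≢0 ∘ m+n≡0⇒n≡0 b))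

pertinent+∈ : ∀ {T A a s} → IPertinentSet T A → a ∈ A → s ∈ T → a + s ∈ T ∪ A
pertinent+∈ {T} {A} {a} {zero}  _            a∈A _   =
  ∈-∪⁺ {T} {A} (inj₂ (subst (_∈ A) (sym (+-identityʳ a)) a∈A))
pertinent+∈ {T} {A} {a} {suc s} (A⊆PF , _)   a∈A s∈T =
  ∈-∪⁺ {T} {A} (inj₁ (proj₂ (A⊆PF a a∈A) (suc s) s∈T λ ()))

∪-closed : ∀ {T A} → NumSg T → IPertinentSet T A →
           ∀ x y → x ∈ T ∪ A → y ∈ T ∪ A → x + y ∈ T ∪ A
∪-closed {T} {A} nsT pert@(A⊆PF , sums∈A) x y x∈ y∈
  with ∈-∪⁻ {T} {A} x∈ | ∈-∪⁻ {T} {A} y∈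
... | inj₁ x∈T | inj₁ y∈T = ∈-∪⁺ {T} {A} (inj₁ (NumSg.closed nsT x y x∈T y∈T))
... | inj₁ x∈T | inj₂ y∈A = subst (_∈ T ∪ A) (+-comm y x) (pertinent+∈ pert y∈A x∈T)
... | inj₂ x∈A | inj₁ y∈T = pertinent+∈ pert x∈A y∈T
... | inj₂ x∈A | inj₂ y∈A with x + y ∈? T
...   | yes x+y∈T = ∈-∪⁺ {T} {A} (inj₁ x+y∈T)
...   | no  x+y∉T = ∈-∪⁺ {T} {A}
  (inj₂ (sums∈A x y x∈A y∈A (PF-+ (A⊆PF x x∈A) (A⊆PF y y∈A) x+y∉T)))

numSg-∪ : ∀ {T A} → NumSg T → IPertinentSet T A → NumSg (T ∪ A)
numSg-∪ {T} {A} nsT pert = record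
  { zero∈    = ∈-∪⁺ {T} {A} (inj₁ zero∈)
  ; closed   = ∪-closed nsT pert
  ; cofinite = let (F , above) = cofinite in F , λ x F<x → ∈-∪⁺ {T} {A} (inj₁ (above x F<x))
  }
  where open NumSg nsT

inJ-between : ∀ {T U} → NumSg T → T ⊆ U → (∀ x → x ∈ U → x ∈ T ⊎ PF T x) → InJ T U
inJ-between {T} {U} nsT T⊆U U⊆T∪PF = nsT , nonempty , nonzero⊆U , absorbs
  where
  open NumSg nsT

  nonempty : Nonempty (nonzeroPart T)
  nonempty = let (F , above) = cofinite in
    suc F , ∈-nonzeroPart⁺ {T} (above (suc F) ≤-refl) λ ()

  nonzero⊆U : nonzeroPart T ⊆ U
  nonzero⊆U t t∈ = T⊆U t (proj₁ (∈-nonzeroPart⁻ {T} t∈))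

  sum∈T : ∀ {t u} → t ∈ T → t ≢ 0 → u ∈ T ⊎ PF T u → t + u ∈ T
  sum∈T {t} {u} t∈T _   (inj₁ u∈T)         = closed t u t∈T u∈T
  sum∈T {t} {u} t∈T t≢0 (inj₂ (_ , u+T⊆T)) = subst (_∈ T) (+-comm u t) (u+T⊆T t t∈T t≢0)

  absorbs : ∀ t u → t ∈ nonzeroPart T → u ∈ U → t + u ∈ nonzeroPart T
  absorbs t u t∈ u∈U =
    let (t∈T , t≢0) = ∈-nonzeroPart⁻ {T} t∈ in
    ∈-nonzeroPart⁺ {T} (sum∈T t∈T t≢0 (U⊆T∪PF u u∈U)) (t≢0 ∘ m+n≡0⇒m≡0 t)

gap : Bool → ℕ
gap true  = 0
gap false = 1

gapsBelow : Subset → ℕ → ℕ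
gapsBelow A zero    = 0
gapsBelow A (suc k) = gap (A k) + gapsBelow A k

gap-antitone : ∀ {a b} → (a ≡ true → b ≡ true) → gap b ≤ gap a
gap-antitone {true}  {true}  _   = z≤n
gap-antitone {true}  {false} a⇒b with () ← a⇒b refl
gap-antitone {false} {true}  _   = z≤n
gap-antitone {false} {false} _   = ≤-refl

gap≡0⇒true : ∀ {a} → gap a ≡ 0 → a ≡ true
gap≡0⇒true {true} _ = refl

gapsBelow-antitone : ∀ {A B} → A ⊆ B → ∀ k → gapsBelow B k ≤ gapsBelow A k
gapsBelow-antitone A⊆B zero    = z≤n
gapsBelow-antitone A⊆B (suc k) =
  +-mono-≤ (gap-antitone (A⊆B k)) (gapsBelow-antitone A⊆B k)

gapsBelow-strict : ∀ {A B} → A ⊆ B → ∀ {x k} → x < k → x ∈ B → x ∉ A →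
                   gapsBelow B k < gapsBelow A k
gapsBelow-strict {A} {B} A⊆B {x} {suc k} x<1+k x∈B x∉A with m<1+n⇒m<n∨m≡n x<1+k
... | inj₁ x<k  = +-mono-≤-< (gap-antitone (A⊆B k)) (gapsBelow-strict A⊆B x<k x∈B x∉A)
... | inj₂ refl rewrite x∈B | ¬-not x∉A = s≤s (gapsBelow-antitone A⊆B x)

gapsBelow≡0⇒∈ : ∀ {A} k → gapsBelow A k ≡ 0 → ∀ {x} → x < k → x ∈ A
gapsBelow≡0⇒∈ {A} (suc k) none {x} x<1+k with m<1+n⇒m<n∨m≡n x<1+k
... | inj₁ x<k  = gapsBelow≡0⇒∈ k (m+n≡0⇒n≡0 (gap (A k)) none) x<k
... | inj₂ refl = gap≡0⇒true (m+n≡0⇒m≡0 (gap (A x)) none)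

full⇒gapsBelow≡0 : ∀ {A} → Full A → ∀ k → gapsBelow A k ≡ 0
full⇒gapsBelow≡0 full zero    = refl
full⇒gapsBelow≡0 full (suc k) rewrite full k = full⇒gapsBelow≡0 full k

gapsBelow-⊊ : ∀ {A B} F → (∀ x → F < x → x ∈ A) → A ⊊ B →
              gapsBelow B (suc F) < gapsBelow A (suc F)
gapsBelow-⊊ F above (A⊆B , x , x∈B , x∉A) =
  gapsBelow-strict A⊆B (s≤s (≮⇒≥ (x∉A ∘ above x))) x∈B x∉A

full? : ∀ {A} F → (∀ x → F < x → x ∈ A) → Dec (Full A)
full? {A} F above with gapsBelow A (suc F) ≟ 0
... | yes none = yes all∈
  where
  all∈ : Full A
  all∈ x with x ≤? F
  ... | yes x≤F = gapsBelow≡0⇒∈ (suc F) none (s≤s x≤F)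
  ... | no  x≰F = above x (≰⇒> x≰F)
... | no  some = no λ full → some (full⇒gapsBelow≡0 full (suc F))

numSg-full? : ∀ {A} → NumSg A → Dec (Full A)
numSg-full? nsA = let (F , above) = NumSg.cofinite nsA in full? F above

first-satisfying : ∀ {P : ℕ → Set} → (∀ n → Dec (P n)) → (measure : ℕ → ℕ) →
                   (∀ n → ¬ P n → measure (suc n) < measure n) →
                   ∃ λ μ → P μ × (∀ i → i < μ → ¬ P i)
first-satisfying {P} P? measure decreases = search (suc (measure 0)) 0 ≤-refl λ _ ()
  where
  search : ∀ fuel m → measure m < fuel → (∀ i → i < m → ¬ P i) →
           ∃ λ μ → P μ × (∀ i → i < μ → ¬ P i)
  search (suc fuel) m m<fuel before with P? m
  ... | yes Pm  = m , Pm , before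
  ... | no  ¬Pm = search fuel (suc m) (<-≤-trans (decreases m ¬Pm) (≤-pred m<fuel)) before′
    where
    before′ : ∀ i → i < suc m → ¬ P i
    before′ i i<1+m with m<1+n⇒m<n∨m≡n i<1+m
    ... | inj₁ i<m  = before i i<m
    ... | inj₂ refl = ¬Pm

module Iteration
  {S : Subset} (nsS : NumSg S) {θ : Subset → Subset} (θ-pertinent : IPertinentMap θ)
  (Sq : ℕ → Subset) (Sq₀≐S : Sq 0 ≐ S)
  (Sq-step : ∀ n → (¬ Full (Sq n) → Sq (suc n) ≐ Sq n ∪ θ (Sq n))
                 × (Full (Sq n) → Full (Sq (suc n))))
  where

  module Growth {n} (nsₙ : NumSg (Sq n)) (not-full : ¬ Full (Sq n)) where
    private
      Sₙ₊₁≐ : Sq (suc n) ≐ Sq n ∪ θ (Sq n)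
      Sₙ₊₁≐ = proj₁ (Sq-step n) not-full

      pertinent : IPertinentSet (Sq n) (θ (Sq n))
      pertinent = proj₂ (θ-pertinent (Sq n) nsₙ not-full)

    numSg : NumSg (Sq (suc n))
    numSg = numSg-≐ Sₙ₊₁≐ (numSg-∪ nsₙ pertinent)

    ⊆-suc : Sq n ⊆ Sq (suc n)
    ⊆-suc x x∈ = ≐⇒⊇ Sₙ₊₁≐ x (∈-∪⁺ {Sq n} {θ (Sq n)} (inj₁ x∈))

    proper : Sq n ⊊ Sq (suc n)
    proper = let (a , a∈θ) = proj₁ (θ-pertinent (Sq n) nsₙ not-full) in
      ⊆-suc , a , ≐⇒⊇ Sₙ₊₁≐ a (∈-∪⁺ {Sq n} {θ (Sq n)} (inj₂ a∈θ)) , proj₁ (proj₁ pertinent a a∈θ)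

    inJ : InJ (Sq n) (Sq (suc n))
    inJ = inJ-between nsₙ ⊆-suc λ x x∈ →
      map₂ (proj₁ pertinent x) (∈-∪⁻ {Sq n} {θ (Sq n)} (≐⇒⊆ Sₙ₊₁≐ x x∈))

  numSg : ∀ n → NumSg (Sq n)
  numSg zero    = numSg-≐ Sq₀≐S nsS
  numSg (suc n) with numSg-full? (numSg n)
  ... | yes full     = full⇒numSg (proj₂ (Sq-step n) full)
  ... | no  not-full = Growth.numSg (numSg n) not-full

  full?ₙ : ∀ n → Dec (Full (Sq n))
  full?ₙ n = numSg-full? (numSg n)

  ⊆-suc : ∀ n → Sq n ⊆ Sq (suc n)
  ⊆-suc n with full?ₙ n
  ... | yes full     = λ x _ → proj₂ (Sq-step n) full x
  ... | no  not-full = Growth.⊆-suc (numSg n) not-full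

  S⊆Sq : ∀ n → S ⊆ Sq n
  S⊆Sq zero    = ≐⇒⊇ Sq₀≐S
  S⊆Sq (suc n) x x∈S = ⊆-suc n x (S⊆Sq n x x∈S)

  F : ℕ
  F = proj₁ (NumSg.cofinite nsS)

  gaps : ℕ → ℕ
  gaps n = gapsBelow (Sq n) (suc F)

  gaps-decrease : ∀ n → ¬ Full (Sq n) → gaps (suc n) < gaps n
  gaps-decrease n not-full =
    gapsBelow-⊊ F (λ x F<x → S⊆Sq n x (proj₂ (NumSg.cofinite nsS) x F<x))
      (Growth.proper (numSg n) not-full)

theorem14 : (S : Subset) → NumSg S → (θ : Subset → Subset) → IPertinentMap θ →
    (Sq : ℕ → Subset) →
    (∀ x → Sq 0 x ≡ S x) →
    (∀ n → (¬ Full (Sq n) → ∀ x → Sq (suc n) x ≡ (Sq n x ∨ θ (Sq n) x))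
         × (Full (Sq n) → Full (Sq (suc n)))) →
    ∃ λ μ → Full (Sq μ)
      × (∀ i → i < μ → Sq i ⊊ Sq (suc i))
      × (∀ i → i ≤ μ → NumSg (Sq i))
      × (∀ i → i < μ → InJ (Sq i) (Sq (suc i)))
theorem14 S nsS θ θ-pertinent Sq Sq₀≐S Sq-step =
  let (μ , full , not-full) = first-satisfying full?ₙ gaps gaps-decrease in
  μ , full
    , (λ i i<μ → Growth.proper (numSg i) (not-full i i<μ))
    , (λ i _ → numSg i)
    , (λ i i<μ → Growth.inJ (numSg i) (not-full i i<μ))
  where open Iteration nsS θ-pertinent Sq Sq₀≐S Sq-step
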